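{- Let $G=(V,E)$ be a cubic graph none of whose connected components is isomorphic to $K_4$, and let $\mathcal{P}$ be a partition of $V$ into nonempty parts. Then (i) $u_{\mathcal{P}}(v)\le\frac13$ for every $v\in V$; and (ii) for every $P\in\mathcal{P}$ such that $G[P]$ is not isomorphic to a triangle, to a diamond, or to the graph $F_1$, we have $u(P)\le\frac14$.
   Context: A cubic graph has all degrees 3. For $S\subseteq V$, $d(S)=|E(S)|/|S|$ with $E(S)$ the set of edges with both endpoints in $S$. For $P\subseteq V$ nonempty and $v\in P$, the utility is $u_P(v)=d(P)/|P|$, and $u(P)=u_P(v)$ (independent of $v$). For a partition $\mathcal{P}$, $u_{\mathcal{P}}(v)=u_{V_i}(v)$ where $V_i\in\mathcal{P}$ contains $v$. A triangle is $K_3$; a diamond is $K_4$ minus one edge. $F_1$ is the graph on vertices $v_1,\dots,v_5$ with edges $v_1v_2,v_2v_3,v_3v_4,v_4v_1,v_2v_4,v_1v_5,v_3v_5$ (a diamond plus a vertex adjacent to its two degree-2 vertices). -}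

module Defs where

open import Data.Nat as ℕ using (ℕ; zero; suc)
open import Data.Integer using (ℤ; +_)
open import Data.Rational as ℚ using (ℚ; 0ℚ; _/_)
open import Data.Bool using (Bool; true; false; _∧_; _∨_; not; if_then_else_)
open import Data.Fin using (Fin; zero; suc; _<?_; #_)
open import Data.Fin.Properties using (_≟_)
open import Data.Fin.Subset using (Subset; _∈_; ∣_∣)
open import Data.List using (List; []; _∷_; map; allFin)
open import Data.Nat.ListAction using (sum)
open import Data.Bool.ListAction using (any)
import Data.Vec
open import Data.Vec using (tabulate)
open import Data.Product using (Σ; ∃; _×_; _,_)
open import Function using (_⇔_)
open import Function.Definitions using (Injective)
open import Relation.Binary.PropositionalEquality using (_≡_)
open import Relation.Nullary using (¬_)
open import Relation.Nullary.Decidable using (⌊_⌋)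

record Graph (n : ℕ) : Set where
  field
    adj    : Fin n → Fin n → Bool
    sym    : ∀ u v → adj u v ≡ adj v u
    irrefl : ∀ v → adj v v ≡ false
open Graph public

count : ∀ {m} → (Fin m → Bool) → ℕ
count {m} p = sum (map (λ i → if p i then 1 else 0) (allFin m))

degree : ∀ {n} → Graph n → Fin n → ℕ
degree G v = count (adj G v)

Cubic : ∀ {n} → Graph n → Set
Cubic G = ∀ v → degree G v ≡ 3

edgesIn : ∀ {n} → Graph n → Subset n → ℕ
edgesIn {n} G S =
  sum (map (λ i → count (λ j → ⌊ i <? j ⌋ ∧ (Data.Vec.lookup S i ∧ (Data.Vec.lookup S j ∧ adj G i j)))) (allFin n))

-- 1/k as a rational (0 when k = 0; only used for nonempty sets).
recip : ℕ → ℚ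
recip zero    = 0ℚ
recip (suc k) = + 1 / suc k

density : ∀ {n} → Graph n → Subset n → ℚ
density G S = (+ edgesIn G S / 1) ℚ.* recip ∣ S ∣

utility : ∀ {n} → Graph n → Subset n → ℚ
utility G P = density G P ℚ.* recip ∣ P ∣

-- Reachability (walks) in G; the connected component of v is {w | Reach G v w}.
data Reach {n} (G : Graph n) : Fin n → Fin n → Set where
  here : ∀ {v} → Reach G v v
  step : ∀ {u w x} → adj G u w ≡ true → Reach G w x → Reach G u x

InducedIso : ∀ {n m} → Graph n → (Fin n → Set) → (Fin m → Fin m → Bool) → Set
InducedIso {n} {m} G S H =
  Σ (Fin m → Fin n) λ f →
    Injective _≡_ _≡_ f
    × (∀ v → S v ⇔ ∃ λ a → f a ≡ v)
    × (∀ a b → adj G (f a) (f b) ≡ H a b)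

eqb : ∀ {m} → Fin m → Fin m → Bool
eqb a b = ⌊ a ≟ b ⌋

fromEdges : ∀ {m} → List (Fin m × Fin m) → Fin m → Fin m → Bool
fromEdges es a b = any (λ { (x , y) → (eqb x a ∧ eqb y b) ∨ (eqb x b ∧ eqb y a) }) es

K4 : Fin 4 → Fin 4 → Bool
K4 a b = not (eqb a b)

Triangle : Fin 3 → Fin 3 → Bool
Triangle a b = not (eqb a b)

Diamond : Fin 4 → Fin 4 → Bool
Diamond = fromEdges ((# 0 , # 1) ∷ (# 1 , # 2) ∷ (# 2 , # 3) ∷ (# 3 , # 0) ∷ (# 0 , # 2) ∷ [])

-- F1 with v1..v5 ↦ 0..4: edges v1v2,v2v3,v3v4,v4v1,v2v4,v1v5,v3v5.
F1 : Fin 5 → Fin 5 → Bool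
F1 = fromEdges ((# 0 , # 1) ∷ (# 1 , # 2) ∷ (# 2 , # 3) ∷ (# 3 , # 0) ∷ (# 1 , # 3) ∷ (# 0 , # 4) ∷ (# 2 , # 4) ∷ [])

record Partition (n : ℕ) : Set where
  field
    k        : ℕ
    part     : Fin n → Fin k
    nonempty : ∀ i → ∃ λ v → part v ≡ i
open Partition public

partSet : ∀ {n} (𝒫 : Partition n) → Fin (k 𝒫) → Subset n
partSet 𝒫 i = tabulate (λ v → eqb (part 𝒫 v) i)

utilityIn : ∀ {n} → Graph n → Partition n → Fin n → ℚ
utilityIn G 𝒫 v = utility G (partSet 𝒫 (part 𝒫 v))

module Submission where

-- For a set S spanning e edges, u(S) = e / |S|², so the claims are 3e ≤ |S|² for every S and
-- 4e ≤ |S|² unless G[S] is a triangle, a diamond or F₁. Since G is cubic, G[S] has maximum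
-- degree 3, whence 2e ≤ 3|S|, which settles |S| ≥ 6. The simple graphs on at most five vertices
-- are checked exhaustively: the only ones that are too dense are the triangle, the diamond, K₄
-- and, among those of maximum degree 3, F₁. An induced K₄ of a cubic graph has no edge leaving
-- it, so it is a whole component, which the hypothesis excludes.

open import Defs hiding (sym)
open import Data.Bool as Bool using (Bool; true; false; T; _∧_; if_then_else_)
open import Data.Bool.Properties using (T-∧)
open import Data.Empty using (⊥; ⊥-elim)
open import Data.Fin using (Fin; zero; suc; _<?_)
import Data.Fin.Properties as Fin
open import Data.Fin.Permutation as Perm using (Permutation; Permutation′; _⟨$⟩ʳ_; _⟨$⟩ˡ_; insert; inverseʳ)
open import Data.Fin.Subset using (Subset; _∈_; ∣_∣)
open import Data.Integer as ℤ using (+_; +≤+)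
import Data.Integer.Properties as ℤ
open import Data.List as List using (List; []; _∷_; allFin; concatMap)
open import Data.List.Relation.Unary.Any using (Any; any?; satisfied)
open import Data.Nat as ℕ using (ℕ; zero; suc; _+_; _*_; _≤_; _≤ᵇ_; _≤?_; z≤n)
import Data.Nat.Properties as ℕ
open import Data.Nat.ListAction using () renaming (sum to listSum)
open import Data.Product as Product using (Σ; ∃; _×_; _,_; proj₁; proj₂)
open import Data.Rational as ℚ using (_/_; 0ℚ; toℚᵘ)
import Data.Rational.Properties as ℚ
open import Data.Rational.Unnormalised as ℚᵘ using (mkℚᵘ; *≤*)
import Data.Rational.Unnormalised.Properties as ℚᵘ
open import Data.Sum as Sum using (_⊎_; inj₁; inj₂)
open import Data.Unit using (tt)
open import Data.Vec using (Vec; []; _∷_; lookup; tabulate; here; there)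
open import Data.Vec.Properties using (lookup∘tabulate; lookup⇒[]=)
open import Function using (_∘_; id; _⇔_; mk⇔; Equivalence; Injection)
open import Function.Definitions using (Injective)
open import Function.Properties.Inverse using (↔⇒↣)
open import Relation.Binary using (tri<; tri≈; tri>)
open import Relation.Binary.PropositionalEquality
open import Relation.Nullary using (¬_; Dec; yes; no; contradiction)
open import Relation.Nullary.Decidable using (⌊_⌋; isYes; toWitness; _×-dec_; _⊎-dec_; _→-dec_)
open import Algebra.Properties.Semiring.Sum ℕ.+-*-semiring using (sum; sum-cong-≗; ∑-distrib-+; ∑-comm)

𝟙 : Bool → ℕ
𝟙 b = if b then 1 else 0

sum-map-tabulate : ∀ {m k} (g : Fin k → ℕ) (h : Fin m → Fin k) →
                   listSum (List.map g (List.tabulate h)) ≡ sum (g ∘ h)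
sum-map-tabulate {zero}  g h = refl
sum-map-tabulate {suc m} g h = cong (_+_ (g (h zero))) (sum-map-tabulate g (h ∘ suc))

count≡sum : ∀ {m} (p : Fin m → Bool) → count p ≡ sum (𝟙 ∘ p)
count≡sum p = sum-map-tabulate (𝟙 ∘ p) id

sum-mono-≤ : ∀ {m} {f g : Fin m → ℕ} → (∀ i → f i ≤ g i) → sum f ≤ sum g
sum-mono-≤ {zero}  f≤g = z≤n
sum-mono-≤ {suc m} f≤g = ℕ.+-mono-≤ (f≤g zero) (sum-mono-≤ (f≤g ∘ suc))

sum-const : ∀ m c → sum {m} (λ _ → c) ≡ m * c
sum-const zero    c = refl
sum-const (suc m) c = cong (_+_ c) (sum-const m c)

term≤sum : ∀ {m} (g : Fin m → ℕ) i → g i ≤ sum g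
term≤sum g zero    = ℕ.m≤m+n _ _
term≤sum g (suc i) = ℕ.≤-trans (term≤sum (g ∘ suc) i) (ℕ.m≤n+m _ (g zero))

sum-split : ∀ {m} (b : Fin m → Bool) (g : Fin m → ℕ) →
            sum g ≡ sum (λ i → if b i then g i else 0) + sum (λ i → if b i then 0 else g i)
sum-split b g = trans (sum-cong-≗ split) 
  (∑-distrib-+ (λ i → if b i then g i else 0) (λ i → if b i then 0 else g i))
  where
  split : ∀ i → g i ≡ (if b i then g i else 0) + (if b i then 0 else g i)
  split i with b i
  ... | true  = sym (ℕ.+-identityʳ _)
  ... | false = refl

AdjMatrix : ℕ → Set
AdjMatrix m = Fin m → Fin m → Bool

record IsSimple {m} (H : AdjMatrix m) : Set where
  field
    symmetric   : ∀ a b → H a b ≡ H b a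
    irreflexive : ∀ a → H a a ≡ false
open IsSimple

_≗₂_ : ∀ {m} → AdjMatrix m → AdjMatrix m → Set
H ≗₂ H′ = ∀ a b → H a b ≡ H′ a b

_≗₂?_ : ∀ {m} (H H′ : AdjMatrix m) → Dec (H ≗₂ H′)
H ≗₂? H′ = Fin.all? λ a → Fin.all? λ b → H a b Bool.≟ H′ a b

degreeOf : ∀ {m} → AdjMatrix m → Fin m → ℕ
degreeOf H a = sum (𝟙 ∘ H a)

arcs : ∀ {m} → AdjMatrix m → ℕ
arcs H = sum (degreeOf H)

MaxDegree : ∀ {m} → ℕ → AdjMatrix m → Set
MaxDegree d H = ∀ a → degreeOf H a ≤ d

module _ {m} {H H′ : AdjMatrix m} (H≗H′ : H ≗₂ H′) where

  degreeOf-cong : ∀ a → degreeOf H a ≡ degreeOf H′ a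
  degreeOf-cong a = sum-cong-≗ (cong 𝟙 ∘ H≗H′ a)

  arcs-cong : arcs H ≡ arcs H′
  arcs-cong = sum-cong-≗ degreeOf-cong

arcs≤ : ∀ {m d} {H : AdjMatrix m} → MaxDegree d H → arcs H ≤ m * d
arcs≤ {m} {d} bounded = ℕ.≤-trans (sum-mono-≤ bounded) (ℕ.≤-reflexive (sum-const m d))

IsoVia : ∀ {m k} → AdjMatrix m → AdjMatrix k → Permutation k m → Set
IsoVia H K π = (λ a b → H (π ⟨$⟩ʳ a) (π ⟨$⟩ʳ b)) ≗₂ K

_≅_ : ∀ {m k} → AdjMatrix m → AdjMatrix k → Set
_≅_ {m} {k} H K = Σ (Permutation k m) (IsoVia H K)

≅-respˡ : ∀ {m k} {H H′ : AdjMatrix m} {K : AdjMatrix k} → H ≗₂ H′ → H′ ≅ K → H ≅ K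
≅-respˡ H≗H′ (π , iso) = π , λ a b → trans (H≗H′ _ _) (iso a b)

permutations : ∀ m → List (Permutation′ m)
permutations zero    = Perm.id ∷ []
permutations (suc m) =
  concatMap (λ π → List.map (λ i → insert zero i π) (allFin (suc m))) (permutations m)

IsoFound : ∀ {m} → AdjMatrix m → AdjMatrix m → Set
IsoFound {m} H K = Any (IsoVia H K) (permutations m)

isoFound? : ∀ {m} (H K : AdjMatrix m) → Dec (IsoFound H K)
isoFound? H K = any? (λ π → (λ a b → H (π ⟨$⟩ʳ a) (π ⟨$⟩ʳ b)) ≗₂? K) (permutations _)

isoFound⇒≅ : ∀ {m} {H K : AdjMatrix m} → IsoFound H K → H ≅ K
isoFound⇒≅ = satisfied

extend : ∀ {m} → Vec Bool m → AdjMatrix m → AdjMatrix (suc m)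
extend N H zero    zero    = false
extend N H zero    (suc b) = lookup N b
extend N H (suc a) zero    = lookup N a
extend N H (suc a) (suc b) = H a b

empty : AdjMatrix 0
empty ()

-- The simple graph with the same strict upper triangle as H.
rebuild : ∀ {m} → AdjMatrix m → AdjMatrix m
rebuild {zero}  H = empty
rebuild {suc m} H = extend (tabulate (H zero ∘ suc)) (rebuild (λ a b → H (suc a) (suc b)))

rebuild-≗₂ : ∀ {m} {H : AdjMatrix m} → IsSimple H → H ≗₂ rebuild H
rebuild-≗₂         simple zero    zero    = irreflexive simple zero
rebuild-≗₂ {H = H} simple zero    (suc b) = sym (lookup∘tabulate (H zero ∘ suc) b)
rebuild-≗₂ {H = H} simple (suc a) zero    =
  trans (symmetric simple (suc a) zero) (sym (lookup∘tabulate (H zero ∘ suc) a))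
rebuild-≗₂ {H = H} simple (suc a) (suc b) = rebuild-≗₂ simple′ a b
  where
  simple′ : IsSimple λ a b → H (suc a) (suc b)
  simple′ = record
    { symmetric   = λ a b → symmetric simple (suc a) (suc b)
    ; irreflexive = irreflexive simple ∘ suc
    }

allVectors : ∀ k → (Vec Bool k → Bool) → Bool
allVectors zero    p = p []
allVectors (suc k) p = allVectors k (p ∘ (true ∷_)) ∧ allVectors k (p ∘ (false ∷_))

allVectors-sound : ∀ {k} {p : Vec Bool k → Bool} → T (allVectors k p) → ∀ v → T (p v)
allVectors-sound {zero}  t []          = t
allVectors-sound {suc k} t (true ∷ v)  = allVectors-sound (proj₁ (Equivalence.to T-∧ t)) v
allVectors-sound {suc k} t (false ∷ v) = allVectors-sound (proj₂ (Equivalence.to T-∧ t)) v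

allGraphs : ∀ m → (AdjMatrix m → Bool) → Bool
allGraphs zero    p = p empty
allGraphs (suc m) p = allGraphs m (λ H → allVectors m (λ N → p (extend N H)))

allGraphs-sound : ∀ {m} {p : AdjMatrix m → Bool} → T (allGraphs m p) → ∀ H → T (p (rebuild H))
allGraphs-sound {zero}  t H = t
allGraphs-sound {suc m} t H =
  allVectors-sound (allGraphs-sound {m} t (λ a b → H (suc a) (suc b))) (tabulate (H zero ∘ suc))

-- `rebuild H` ranges over all simple graphs on Fin m (`rebuild-≗₂`).
every-simple-graph : ∀ {m} {P : AdjMatrix m → Set} (P? : ∀ H → Dec (P H)) →
                     T (allGraphs m (isYes ∘ P?)) → ∀ H → P (rebuild H)
every-simple-graph P? t H = toWitness (allGraphs-sound t H)

module _ {m} {H : AdjMatrix m} (simple : IsSimple H) where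

  arcs≤-rebuild : ∀ {c} → arcs (rebuild H) ≤ c → arcs H ≤ c
  arcs≤-rebuild = subst (_≤ _) (sym (arcs-cong (rebuild-≗₂ simple)))

  ≅-rebuild : ∀ {K} → IsoFound (rebuild H) K → H ≅ K
  ≅-rebuild found = ≅-respˡ (rebuild-≗₂ simple) (isoFound⇒≅ {H = rebuild H} found)

maxDegree? : ∀ {m} d (H : AdjMatrix m) → Dec (MaxDegree d H)
maxDegree? d H = Fin.all? λ a → degreeOf H a ≤? d

-- Each `tt` is checked by running the search over all simple graphs of the given order; the
-- block is opaque so that case analysis on these lemmas never unfolds that search.
opaque
  order₁-edgeless : (H : AdjMatrix 1) → IsSimple H → arcs H ≤ 0
  order₁-edgeless H simple = arcs≤-rebuild simple (every-simple-graph (λ H → arcs H ≤? 0) tt H)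

  order₂-arcs≤2 : (H : AdjMatrix 2) → IsSimple H → arcs H ≤ 2
  order₂-arcs≤2 H simple = arcs≤-rebuild simple (every-simple-graph (λ H → arcs H ≤? 2) tt H)

  order₃-sparse-or-triangle : (H : AdjMatrix 3) → IsSimple H →
                              arcs H ≤ 4 ⊎ (arcs H ≤ 6 × H ≅ Triangle)
  order₃-sparse-or-triangle H simple =
    Sum.map (arcs≤-rebuild simple) (Product.map (arcs≤-rebuild simple) (≅-rebuild simple))
      (every-simple-graph (λ H → arcs H ≤? 4 ⊎-dec arcs H ≤? 6 ×-dec isoFound? H Triangle) tt H)

  order₄-sparse-diamond-or-K4 : (H : AdjMatrix 4) → IsSimple H →
                                arcs H ≤ 8 ⊎ (arcs H ≤ 10 × H ≅ Diamond) ⊎ H ≗₂ K4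
  order₄-sparse-diamond-or-K4 H simple =
    Sum.map (arcs≤-rebuild simple)
            (Sum.map (Product.map (arcs≤-rebuild simple) (≅-rebuild simple))
                     (λ k4 a b → trans (rebuild-≗₂ simple a b) (k4 a b)))
      (every-simple-graph
        (λ H → arcs H ≤? 8 ⊎-dec arcs H ≤? 10 ×-dec isoFound? H Diamond ⊎-dec H ≗₂? K4) tt H)

  order₅-sparse-or-F1 : (H : AdjMatrix 5) → IsSimple H → MaxDegree 3 H →
                        arcs H ≤ 12 ⊎ (arcs H ≤ 14 × H ≅ F1)
  order₅-sparse-or-F1 H simple subcubic =
    Sum.map (arcs≤-rebuild simple) (Product.map (arcs≤-rebuild simple) (≅-rebuild simple))
      (every-simple-graph
        (λ H → maxDegree? 3 H →-dec (arcs H ≤? 12 ⊎-dec arcs H ≤? 14 ×-dec isoFound? H F1)) tt H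
        λ a → subst (_≤ 3) (degreeOf-cong (rebuild-≗₂ simple) a) (subcubic a))

graph-simple : ∀ {n} (G : Graph n) → IsSimple (adj G)
graph-simple G = record { symmetric = Graph.sym G ; irreflexive = irrefl G }

restrict : ∀ {n} → (Fin n → Bool) → AdjMatrix n → AdjMatrix n
restrict b H i j = b i ∧ (b j ∧ H i j)

restrict-simple : ∀ {n} (b : Fin n → Bool) {H : AdjMatrix n} → IsSimple H → IsSimple (restrict b H)
restrict-simple b {H} simple = record { symmetric = symmetric′ ; irreflexive = irreflexive′ }
  where
  symmetric′ : ∀ i j → restrict b H i j ≡ restrict b H j i
  symmetric′ i j with b i | b j
  ... | true  | true  = symmetric simple i j
  ... | true  | false = refl
  ... | false | true  = refl
  ... | false | false = refl
  irreflexive′ : ∀ i → restrict b H i i ≡ false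
  irreflexive′ i with b i
  ... | true  = irreflexive simple i
  ... | false = refl

𝟙-∧ : ∀ b c → (if b then 𝟙 c else 0) ≡ 𝟙 (b ∧ c)
𝟙-∧ true  c = refl
𝟙-∧ false c = refl

upper : ∀ {n} → AdjMatrix n → Fin n → Fin n → ℕ
upper X i j = 𝟙 (⌊ i <? j ⌋ ∧ X i j)

upperArcs : ∀ {n} → AdjMatrix n → ℕ
upperArcs X = sum λ i → sum λ j → upper X i j

module _ {n} {X : AdjMatrix n} (simple : IsSimple X) where

  𝟙≡upper+upper : ∀ i j → 𝟙 (X i j) ≡ upper X i j + upper X j i
  𝟙≡upper+upper i j with i <? j | j <? i
  ... | yes i<j | yes j<i = ⊥-elim (Fin.<-asym i<j j<i)
  ... | yes _   | no _    = sym (ℕ.+-identityʳ _)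
  ... | no _    | yes _   = cong 𝟙 (symmetric simple i j)
  ... | no i≮j  | no j≮i  with Fin.<-cmp i j
  ...   | tri< i<j _ _    = ⊥-elim (i≮j i<j)
  ...   | tri≈ _ refl _   = cong 𝟙 (irreflexive simple i)
  ...   | tri> _ _ j<i    = ⊥-elim (j≮i j<i)

  arcs≡2*upperArcs : arcs X ≡ 2 * upperArcs X
  arcs≡2*upperArcs = begin
    arcs X                                    ≡⟨ sum-cong-≗ (λ i → sum-cong-≗ (𝟙≡upper+upper i)) ⟩
    sum (λ i → sum λ j → U i j + U j i)       ≡⟨ sum-cong-≗ (λ i → ∑-distrib-+ (U i) (λ j → U j i)) ⟩
    sum (λ i → sum (U i) + sum λ j → U j i)   ≡⟨ ∑-distrib-+ (sum ∘ U) (λ i → sum λ j → U j i) ⟩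
    upperArcs X + sum (λ i → sum λ j → U j i) ≡⟨ cong (_+_ (upperArcs X)) (∑-comm (λ i j → U j i)) ⟩
    upperArcs X + upperArcs X                 ≡⟨ cong (_+_ (upperArcs X)) (ℕ.+-identityʳ _) ⟨
    2 * upperArcs X                           ∎
    where
    open ≡-Reasoning
    U : Fin n → Fin n → ℕ
    U = upper X

members : ∀ {n} (S : Subset n) → Fin ∣ S ∣ → Fin n
members (true  ∷ S) zero    = zero
members (true  ∷ S) (suc a) = suc (members S a)
members (false ∷ S) a       = suc (members S a)

members-injective : ∀ {n} (S : Subset n) → Injective _≡_ _≡_ (members S)
members-injective (true  ∷ S) {zero}  {zero}  _  = refl
members-injective (true  ∷ S) {suc a} {suc b} eq = cong suc (members-injective S (Fin.suc-injective eq))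
members-injective (false ∷ S)                 eq = members-injective S (Fin.suc-injective eq)

members-∈ : ∀ {n} (S : Subset n) a → members S a ∈ S
members-∈ (true  ∷ S) zero    = here
members-∈ (true  ∷ S) (suc a) = there (members-∈ S a)
members-∈ (false ∷ S) a       = there (members-∈ S a)

∈⇒member : ∀ {n} {S : Subset n} {v} → v ∈ S → ∃ λ a → members S a ≡ v
∈⇒member {S = true  ∷ S} here      = zero , refl
∈⇒member {S = true  ∷ S} (there p) = Product.map suc (cong suc) (∈⇒member p)
∈⇒member {S = false ∷ S} (there p) = Product.map id (cong suc) (∈⇒member p)

sum-members : ∀ {n} (S : Subset n) (g : Fin n → ℕ) →
              sum (λ v → if lookup S v then g v else 0) ≡ sum (g ∘ members S)
sum-members []          g = refl
sum-members (true  ∷ S) g = cong (_+_ (g zero)) (sum-members S (g ∘ suc))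
sum-members (false ∷ S) g = sum-members S (g ∘ suc)

-- A listing of S without repetition, with the reindexing of sums over S that it induces. Its
-- length is a variable rather than ∣ S ∣ so that `edgeBounds` can case-split on it.
record Enumeration {n} (S : Subset n) (m : ℕ) : Set where
  field
    vertex      : Fin m → Fin n
    injective   : Injective _≡_ _≡_ vertex
    image       : ∀ v → v ∈ S ⇔ ∃ λ a → vertex a ≡ v
    sum-vertex  : ∀ g → sum (λ v → if lookup S v then g v else 0) ≡ sum (g ∘ vertex)

members-enumeration : ∀ {n} (S : Subset n) → Enumeration S ∣ S ∣
members-enumeration S = record
  { vertex     = members S
  ; injective  = members-injective S
  ; image      = λ v → mk⇔ ∈⇒member λ { (a , refl) → members-∈ S a }
  ; sum-vertex = sum-members S
  }

reach-preserves : ∀ {n} {G : Graph n} {P : Fin n → Set} →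
                  (∀ {u w} → P u → adj G u w ≡ true → P w) → ∀ {v w} → P v → Reach G v w → P w
reach-preserves closed pv here        = pv
reach-preserves closed pv (step uw r) = reach-preserves closed (closed pv uw) r

module _ {n} (G : Graph n) {S : Subset n} {m} (E : Enumeration S m) where
  open Enumeration E

  induced : AdjMatrix m
  induced a b = adj G (vertex a) (vertex b)

  induced-simple : IsSimple induced
  induced-simple = record
    { symmetric   = λ a b → Graph.sym G (vertex a) (vertex b)
    ; irreflexive = irrefl G ∘ vertex
    }

  outsideDegree : Fin n → ℕ
  outsideDegree u = sum λ v → if lookup S v then 0 else 𝟙 (adj G u v)

  degree-split : ∀ a → degree G (vertex a) ≡ degreeOf induced a + outsideDegree (vertex a)
  degree-split a = begin
    degree G u
      ≡⟨ count≡sum (adj G u) ⟩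
    sum (𝟙 ∘ adj G u)
      ≡⟨ sum-split (lookup S) (𝟙 ∘ adj G u) ⟩
    sum (λ v → if lookup S v then 𝟙 (adj G u v) else 0) + outsideDegree u
      ≡⟨ cong (_+ outsideDegree u) (sum-vertex (𝟙 ∘ adj G u)) ⟩
    degreeOf induced a + outsideDegree u
      ∎
    where
    open ≡-Reasoning
    u : Fin n
    u = vertex a

  induced-maxDegree : Cubic G → MaxDegree 3 induced
  induced-maxDegree cubic a =
    subst (degreeOf induced a ≤_) (trans (sym (degree-split a)) (cubic (vertex a))) (ℕ.m≤m+n _ _)

  induced-closed : Cubic G → ∀ {a w} → degreeOf induced a ≡ 3 → adj G (vertex a) w ≡ true → w ∈ S
  induced-closed cubic {a} {w} full aw with lookup S w in w∈?S
  ... | true  = lookup⇒[]= w S w∈?S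
  ... | false = contradiction (subst (1 ≤_) nothing-outside edge-outside) λ ()
    where
    u : Fin n
    u = vertex a
    nothing-outside : outsideDegree u ≡ 0
    nothing-outside = ℕ.+-cancelˡ-≡ 3 _ _
      (trans (cong (_+ outsideDegree u) (sym full)) (trans (sym (degree-split a)) (cubic u)))
    term≡1 : (if lookup S w then 0 else 𝟙 (adj G u w)) ≡ 1
    term≡1 rewrite w∈?S | aw = refl
    edge-outside : 1 ≤ outsideDegree u
    edge-outside = subst (_≤ outsideDegree u) term≡1 (term≤sum _ w)

  arcs-induced : arcs induced ≡ 2 * edgesIn G S
  arcs-induced = begin
    arcs induced                                ≡⟨ sum-vertex-rows ⟨
    sum (λ i → if lookup S i then row i else 0) ≡⟨ sum-cong-≗ row≡degreeOf ⟩
    arcs within                                 ≡⟨ arcs≡2*upperArcs within-simple ⟩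
    2 * upperArcs within                        ≡⟨ cong (2 *_) edgesIn≡upperArcs ⟨
    2 * edgesIn G S                             ∎
    where
    open ≡-Reasoning
    within : AdjMatrix n
    within = restrict (lookup S) (adj G)
    within-simple : IsSimple within
    within-simple = restrict-simple (lookup S) (graph-simple G)
    row : Fin n → ℕ
    row i = sum λ j → if lookup S j then 𝟙 (adj G i j) else 0
    sum-vertex-rows : sum (λ i → if lookup S i then row i else 0) ≡ arcs induced
    sum-vertex-rows = trans (sum-vertex row) (sum-cong-≗ λ a → sum-vertex (𝟙 ∘ adj G (vertex a)))
    row≡degreeOf : ∀ i → (if lookup S i then row i else 0) ≡ degreeOf within i
    row≡degreeOf i with lookup S i
    ... | true  = sum-cong-≗ λ j → 𝟙-∧ (lookup S j) (adj G i j)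
    ... | false = sym (trans (sum-const n 0) (ℕ.*-zeroʳ n))
    above : Fin n → Fin n → Bool
    above i j = ⌊ i <? j ⌋ ∧ within i j
    edgesIn≡upperArcs : edgesIn G S ≡ upperArcs within
    edgesIn≡upperArcs = trans (sum-map-tabulate (count ∘ above) id) (sum-cong-≗ (count≡sum ∘ above))

  induced-iso : ∀ {k} {K : AdjMatrix k} → induced ≅ K → InducedIso G (_∈ S) K
  induced-iso (π , iso) = vertex ∘ (π ⟨$⟩ʳ_) , Injection.injective (↔⇒↣ π) ∘ injective , image′ , iso
    where
    image′ : ∀ v → v ∈ S ⇔ ∃ λ a → vertex (π ⟨$⟩ʳ a) ≡ v
    image′ v = mk⇔
      (λ v∈S → let (b , eq) = Equivalence.to (image v) v∈S in π ⟨$⟩ˡ b , trans (cong vertex (inverseʳ π)) eq)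
      (λ (a , eq) → Equivalence.from (image v) (π ⟨$⟩ʳ a , eq))

K4-regular : ∀ a → degreeOf K4 a ≡ 3
K4-regular zero                   = refl
K4-regular (suc zero)             = refl
K4-regular (suc (suc zero))       = refl
K4-regular (suc (suc (suc zero))) = refl

-- An induced K4 in a cubic graph has no edges leaving it, so it is a whole component.
induced-K4-component : ∀ {n} (G : Graph n) → Cubic G → ∀ {S} (E : Enumeration S 4) →
                       induced G E ≗₂ K4 → InducedIso G (Reach G (Enumeration.vertex E zero)) K4
induced-K4-component G cubic E k4 = vertex , injective , reach⇔image , k4
  where
  open Enumeration E
  closed : ∀ {u w} → (∃ λ a → vertex a ≡ u) → adj G u w ≡ true → ∃ λ b → vertex b ≡ w
  closed (a , refl) aw =
    Equivalence.to (image _) (induced-closed G E cubic (trans (degreeOf-cong k4 a) (K4-regular a)) aw)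
  reach⇔image : ∀ w → Reach G (vertex zero) w ⇔ ∃ λ a → vertex a ≡ w
  reach⇔image w = mk⇔ (reach-preserves closed (zero , refl)) λ where
    (zero  , refl) → here
    (suc a , refl) → step (k4 zero (suc a)) here

UnlessSpecial : ∀ {n} → Graph n → Subset n → Set → Set
UnlessSpecial G S X =
  ¬ InducedIso G (_∈ S) Triangle → ¬ InducedIso G (_∈ S) Diamond → ¬ InducedIso G (_∈ S) F1 → X

module _ {n} (G : Graph n) (cubic : Cubic G) (noK4 : ∀ v → ¬ InducedIso G (Reach G v) K4)
         (S : Subset n) where

  EdgeBounds : ℕ → Set
  EdgeBounds m = 3 * edgesIn G S ≤ m * m × UnlessSpecial G S (4 * edgesIn G S ≤ m * m)

  module _ {m} (E : Enumeration S m) where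

    edges≤ : ∀ c → arcs (induced G E) ≤ 2 * c → edgesIn G S ≤ c
    edges≤ c arcs≤2c = ℕ.*-cancelˡ-≤ 2 (subst (_≤ 2 * c) (arcs-induced G E) arcs≤2c)

    4e⇒EdgeBounds : 4 * edgesIn G S ≤ m * m → EdgeBounds m
    4e⇒EdgeBounds 4e≤mm = ℕ.≤-trans (ℕ.*-monoˡ-≤ (edgesIn G S) (ℕ.n≤1+n 3)) 4e≤mm , λ _ _ _ → 4e≤mm

    -- The numeric side conditions below are closed by evaluation at each use.
    sparse : ∀ c → arcs (induced G E) ≤ 2 * c → {T (4 * c ≤ᵇ m * m)} → EdgeBounds m
    sparse c few {4c≤mm} = 4e⇒EdgeBounds (ℕ.≤-trans (ℕ.*-monoʳ-≤ 4 (edges≤ c few)) (ℕ.≤ᵇ⇒≤ _ _ 4c≤mm))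

    special : ∀ c → arcs (induced G E) ≤ 2 * c → {T (3 * c ≤ᵇ m * m)} →
              UnlessSpecial G S ⊥ → EdgeBounds m
    special c few {3c≤mm} isSpecial =
      ℕ.≤-trans (ℕ.*-monoʳ-≤ 3 (edges≤ c few)) (ℕ.≤ᵇ⇒≤ _ _ 3c≤mm) ,
      λ ¬t ¬d ¬f → ⊥-elim (isSpecial ¬t ¬d ¬f)

    large : 6 ≤ m → EdgeBounds m
    large 6≤m = 4e⇒EdgeBounds (begin
      4 * edgesIn G S       ≡⟨ ℕ.*-assoc 2 2 (edgesIn G S) ⟩
      2 * (2 * edgesIn G S) ≤⟨ ℕ.*-monoʳ-≤ 2 2e≤3m ⟩
      2 * (3 * m)           ≡⟨ ℕ.*-assoc 2 3 m ⟨
      6 * m                 ≤⟨ ℕ.*-monoˡ-≤ m 6≤m ⟩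
      m * m                 ∎)
      where
      open ℕ.≤-Reasoning
      2e≤3m : 2 * edgesIn G S ≤ 3 * m
      2e≤3m = subst₂ _≤_ (arcs-induced G E) (ℕ.*-comm m 3) (arcs≤ (induced-maxDegree G E cubic))

  edgeBounds : ∀ {m} → Enumeration S m → EdgeBounds m
  edgeBounds {0} E = sparse E 0 z≤n
  edgeBounds {1} E = sparse E 0 (order₁-edgeless _ (induced-simple G E))
  edgeBounds {2} E = sparse E 1 (order₂-arcs≤2 _ (induced-simple G E))
  edgeBounds {3} E with order₃-sparse-or-triangle _ (induced-simple G E)
  ... | inj₁ few         = sparse E 2 few
  ... | inj₂ (few , iso) = special E 3 few λ ¬t _ _ → ¬t (induced-iso G E iso)
  edgeBounds {4} E with order₄-sparse-diamond-or-K4 _ (induced-simple G E)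
  ... | inj₁ few                = sparse E 4 few
  ... | inj₂ (inj₁ (few , iso)) = special E 5 few λ _ ¬d _ → ¬d (induced-iso G E iso)
  ... | inj₂ (inj₂ k4)          = ⊥-elim (noK4 _ (induced-K4-component G cubic E k4))
  edgeBounds {5} E with order₅-sparse-or-F1 _ (induced-simple G E) (induced-maxDegree G E cubic)
  ... | inj₁ few         = sparse E 6 few
  ... | inj₂ (few , iso) = special E 7 few λ _ _ ¬f → ¬f (induced-iso G E iso)
  edgeBounds {suc (suc (suc (suc (suc (suc r)))))} E = large E (ℕ.m≤m+n 6 r)

ratio≤-pos : ∀ e k d → suc d * e ≤ suc k * suc k →
             (+ e / 1) ℚ.* (+ 1 / suc k) ℚ.* (+ 1 / suc k) ℚ.≤ + 1 / suc d
ratio≤-pos e k d de≤kk =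
  ℚ.toℚᵘ-cancel-≤ (ℚᵘ.≤-respˡ-≃ (ℚᵘ.≃-sym toℚᵘ-lhs)
                  (ℚᵘ.≤-respʳ-≃ (ℚᵘ.≃-sym (ℚ.toℚᵘ-fromℚᵘ (mkℚᵘ (+ 1) d))) cross))
  where
  toℚᵘ-lhs : toℚᵘ ((+ e / 1) ℚ.* (+ 1 / suc k) ℚ.* (+ 1 / suc k))
             ℚᵘ.≃ mkℚᵘ (+ e) 0 ℚᵘ.* mkℚᵘ (+ 1) k ℚᵘ.* mkℚᵘ (+ 1) k
  toℚᵘ-lhs = ℚᵘ.≃-trans (ℚ.toℚᵘ-homo-* ((+ e / 1) ℚ.* (+ 1 / suc k)) (+ 1 / suc k))
    (ℚᵘ.*-cong (ℚᵘ.≃-trans (ℚ.toℚᵘ-homo-* (+ e / 1) (+ 1 / suc k))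
                          (ℚᵘ.*-cong (ℚ.toℚᵘ-fromℚᵘ (mkℚᵘ (+ e) 0)) (ℚ.toℚᵘ-fromℚᵘ (mkℚᵘ (+ 1) k))))
               (ℚ.toℚᵘ-fromℚᵘ (mkℚᵘ (+ 1) k)))
  numerator : (+ e ℤ.* + 1 ℤ.* + 1) ℤ.* + suc d ≡ + (suc d * e)
  numerator = trans (cong (ℤ._* + suc d) (trans (ℤ.*-identityʳ (+ e ℤ.* + 1)) (ℤ.*-identityʳ (+ e))))
                    (trans (sym (ℤ.pos-* e (suc d))) (cong +_ (ℕ.*-comm e (suc d))))
  denominator : + 1 ℤ.* + (1 * suc k * suc k) ≡ + (suc k * suc k)
  denominator = trans (ℤ.*-identityˡ _) (cong (λ z → + (z * suc k)) (ℕ.*-identityˡ (suc k)))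
  cross : mkℚᵘ (+ e) 0 ℚᵘ.* mkℚᵘ (+ 1) k ℚᵘ.* mkℚᵘ (+ 1) k ℚᵘ.≤ mkℚᵘ (+ 1) d
  cross = *≤* (subst₂ ℤ._≤_ (sym numerator) (sym denominator) (+≤+ de≤kk))

-- For k = 0 the junk value recip 0 = 0 makes the left side 0; this is why empty parts are harmless.
ratio≤ : ∀ e k d → suc d * e ≤ k * k → (+ e / 1) ℚ.* recip k ℚ.* recip k ℚ.≤ + 1 / suc d
ratio≤ e (suc k) d = ratio≤-pos e k d
ratio≤ e zero    d _ =
  subst (ℚ._≤ + 1 / suc d) vanish (ratio≤-pos 0 0 d (subst (_≤ 1) (sym (ℕ.*-zeroʳ (suc d))) z≤n))
  where
  vanish : (+ 0 / 1) ℚ.* (+ 1 / 1) ℚ.* (+ 1 / 1) ≡ (+ e / 1) ℚ.* 0ℚ ℚ.* 0ℚ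
  vanish = sym (cong (ℚ._* 0ℚ) (ℚ.*-zeroʳ (+ e / 1)))

utility-bounds : ∀ {n} (G : Graph n) → Cubic G → (∀ v → ¬ InducedIso G (Reach G v) K4) →
                 (S : Subset n) →
                 utility G S ℚ.≤ + 1 / 3 × UnlessSpecial G S (utility G S ℚ.≤ + 1 / 4)
utility-bounds G cubic noK4 S =
  ratio≤ (edgesIn G S) ∣ S ∣ 2 three , λ ¬t ¬d ¬f → ratio≤ (edgesIn G S) ∣ S ∣ 3 (four ¬t ¬d ¬f)
  where
  three : 3 * edgesIn G S ≤ ∣ S ∣ * ∣ S ∣
  three = proj₁ (edgeBounds G cubic noK4 S (members-enumeration S))
  four : UnlessSpecial G S (4 * edgesIn G S ≤ ∣ S ∣ * ∣ S ∣)
  four = proj₂ (edgeBounds G cubic noK4 S (members-enumeration S))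

lemma8 : ∀ {n} (G : Graph n) → Cubic G
       → (∀ v → ¬ InducedIso G (Reach G v) K4)
       → (𝒫 : Partition n)
       → (∀ v → utilityIn G 𝒫 v ℚ.≤ + 1 / 3)
         × (∀ i → ¬ InducedIso G (_∈ partSet 𝒫 i) Triangle
                → ¬ InducedIso G (_∈ partSet 𝒫 i) Diamond
                → ¬ InducedIso G (_∈ partSet 𝒫 i) F1
                → utility G (partSet 𝒫 i) ℚ.≤ + 1 / 4)
lemma8 G cubic noK4 𝒫 =
  (λ v → proj₁ (utility-bounds G cubic noK4 (partSet 𝒫 (part 𝒫 v)))) ,
  (λ i → proj₂ (utility-bounds G cubic noK4 (partSet 𝒫 i)))
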